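{- Let $S\subseteq\{0,1\}^n$ be a cube-ideal set-system with connectivity at least $2$. Then the $2$-cover graph $G(S)$ is a comparability graph (of a preorder on $[n]$).
   Context: A set-system is a subset $S\subseteq\{0,1\}^n$ with convex hull $\mathrm{conv}(S)$. A GSC inequality is $\sum_{i\in I}x_i+\sum_{j\in J}(1-x_j)\geq1$ for disjoint $I,J\subseteq[n]$, using $|I|+|J|$ variables; capacity inequalities are $x_i\geq0$, $x_i\leq1$. $S$ is cube-ideal if $\mathrm{conv}(S)$ is the solution set of a finite family of capacity and GSC inequalities. The connectivity of $S$ is the minimum number of variables in a GSC inequality valid for $\mathrm{conv}(S)$ ($+\infty$ if $S=\{0,1\}^n$). The $2$-cover graph $G(S)$ is the graph on $[n]$ with an edge $\{i,j\}$ for each pair of distinct indices such that at least one of $x_i+(1-x_j)\geq1$, $(1-x_i)+x_j\geq1$, $x_i+x_j\geq1$, $(1-x_i)+(1-x_j)\geq1$ is valid for $\mathrm{conv}(S)$. A preorder on $[n]$ is a reflexive transitive binary relation; its comparability graph has vertex set $[n]$ and an edge between every two distinct comparable elements.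
   Formalization: The convex hull conv(S) is taken in ℚ^n with rational convex weights, so cube-idealness, connectivity and the edges of the 2-cover graph G(S) refer to validity on rational points. -}

module Defs where

open import Data.Bool using (Bool; true; false; if_then_else_)
open import Data.Fin using (Fin)
open import Data.Fin.Subset using (Subset; _∈_; ∣_∣)
open import Data.Nat as ℕ using (ℕ; _≥_)
open import Data.List using (List; []; _∷_; map; foldr)
open import Data.List.Relation.Unary.All using (All)
open import Data.Product using (Σ; ∃; _×_; _,_; proj₁; proj₂)
open import Data.Sum using (_⊎_)
open import Data.Vec using (tabulate)
open import Data.Rational using (ℚ; 0ℚ; 1ℚ; _+_; _-_; _*_; _≤_)
open import Relation.Nullary using (¬_)
open import Relation.Binary.PropositionalEquality using (_≡_; _≢_)
open import Relation.Binary using (Rel; IsPreorder)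
open import Function.Bundles using (_⇔_)
open import Level using (0ℓ)

Cube : ℕ → Set
Cube n = Fin n → Bool

Point : ℕ → Set
Point n = Fin n → ℚ

SetSystem : ℕ → Set₁
SetSystem n = Cube n → Set

embed : ∀ {n} → Cube n → Point n
embed v i = if v i then 1ℚ else 0ℚ

sumℚ : List ℚ → ℚ
sumℚ = foldr _+_ 0ℚ

InConv : ∀ {n} → SetSystem n → Point n → Set
InConv {n} S x =
  Σ (List (Σ (Cube n) S × ℚ)) λ ws →
    All (λ p → 0ℚ ≤ proj₂ p) ws
    × sumℚ (map proj₂ ws) ≡ 1ℚ
    × (∀ i → x i ≡ sumℚ (map (λ p → proj₂ p * embed (proj₁ (proj₁ p)) i) ws))

ValidFor : ∀ {n} → SetSystem n → (Point n → Set) → Set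
ValidFor S P = ∀ x → InConv S x → P x

Disjoint : ∀ {n} → Subset n → Subset n → Set
Disjoint {n} I J = ∀ (i : Fin n) → ¬ (i ∈ I × i ∈ J)

gscLHS : ∀ {n} → Subset n → Subset n → Point n → ℚ
gscLHS {n} I J x =
  sumℚ (map (λ i → (if Data.Vec.lookup I i then x i else 0ℚ)
                  + (if Data.Vec.lookup J i then 1ℚ - x i else 0ℚ))
            (Data.List.allFin n))

GSC : ∀ {n} → Subset n → Subset n → Point n → Set
GSC I J x = 1ℚ ≤ gscLHS I J x

data Ineq (n : ℕ) : Set where
  cap≥0 : Fin n → Ineq n
  cap≤1 : Fin n → Ineq n
  gsc   : (I J : Subset n) → Disjoint I J → Ineq n

Sat : ∀ {n} → Point n → Ineq n → Set
Sat x (cap≥0 i)   = 0ℚ ≤ x i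
Sat x (cap≤1 i)   = x i ≤ 1ℚ
Sat x (gsc I J _) = GSC I J x

CubeIdeal : ∀ {n} → SetSystem n → Set
CubeIdeal {n} S =
  Σ (List (Ineq n)) λ F → ∀ (x : Point n) → InConv S x ⇔ All (Sat x) F

ConnectivityAtLeast : ∀ {n} → ℕ → SetSystem n → Set
ConnectivityAtLeast {n} k S =
  ∀ (I J : Subset n) → Disjoint I J → ValidFor S (GSC I J) → ∣ I ∣ ℕ.+ ∣ J ∣ ≥ k

CoverEdge : ∀ {n} → SetSystem n → Fin n → Fin n → Set
CoverEdge S i j =
  i ≢ j ×
  (  ValidFor S (λ x → 1ℚ ≤ x i + (1ℚ - x j))
   ⊎ ValidFor S (λ x → 1ℚ ≤ (1ℚ - x i) + x j)
   ⊎ ValidFor S (λ x → 1ℚ ≤ x i + x j)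
   ⊎ ValidFor S (λ x → 1ℚ ≤ (1ℚ - x i) + (1ℚ - x j)))

ComparabilityEdge : ∀ {n} → Rel (Fin n) 0ℓ → Fin n → Fin n → Set
ComparabilityEdge R i j = i ≢ j × (R i j ⊎ R j i)

IsComparabilityGraph : ∀ {n} → (Fin n → Fin n → Set) → Set₁
IsComparabilityGraph {n} E =
  Σ (Rel (Fin n) 0ℓ) λ R → IsPreorder _≡_ R × (∀ i j → E i j ⇔ ComparabilityEdge R i j)

{-# OPTIONS --safe #-}
-- The centre ½·𝟙 of the cube satisfies every capacity inequality and every GSC inequality with at
-- least two variables, so for a cube-ideal S of connectivity ≥ 2 it lies in conv(S). Each valid
-- two-literal inequality ℓᵢ + ℓⱼ ≥ 1 holds with equality at the centre, hence at every vertex t ∈ S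
-- carrying positive weight in a convex representation of the centre: at such a t exactly one of ℓᵢ, ℓⱼ
-- is true. Put i ≲ j when (literal of i true at t) + (literal of j false at t) ≥ 1 is valid. Adding two
-- such inequalities cancels the complementary literals of the middle variable, which gives
-- transitivity, and by the exactly-one property every 2-cover edge {i, j} is i ≲ j or j ≲ i.
module Submission where

open import Defs
open import Data.Nat using (ℕ; zero; suc; s≤s)
import Data.Nat as ℕ
open import Data.Bool using (Bool; true; false; not; if_then_else_)
open import Data.Fin using (Fin; zero; suc)
open import Data.Fin.Subset using (Subset; ∣_∣)
open import Data.Vec using ([]; _∷_; lookup)
open import Data.List using (List; []; _∷_; map)
open import Data.List.Properties using (map-tabulate)
open import Data.List.Relation.Unary.All as All using (All; []; _∷_)
open import Data.List.Relation.Unary.Any using (here; there)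
open import Data.List.Membership.Propositional using () renaming (_∈_ to _∈ₗ_)
open import Data.Product using (Σ; ∃; _×_; _,_; proj₁; proj₂)
open import Data.Sum using (_⊎_; inj₁; inj₂)
open import Data.Rational using (ℚ; 0ℚ; 1ℚ; ½; _+_; _-_; _*_; -_; _≤_; _<_; positive; nonNegative)
open import Data.Rational.Properties
  using (module ≤-Reasoning; positive⁻¹; ≤-refl; ≤-trans; ≤-reflexive; ≤-antisym;
         _<?_; <-irrefl; <-≤-trans; ≮⇒≥; ≤ᵇ⇒≤;
         +-mono-≤; +-monoˡ-≤; +-monoʳ-≤; +-comm; +-assoc; +-identityˡ; +-identityʳ;
         *-identityˡ; *-identityʳ; *-monoˡ-≤-nonNeg; *-cancelˡ-≤-pos)
open import Data.Rational.Solver using (module +-*-Solver)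
open import Data.Unit using (tt)
open import Data.Empty using (⊥-elim)
open import Relation.Nullary using (yes; no)
open import Relation.Binary using (IsPreorder)
open import Relation.Binary.PropositionalEquality
open import Function using (_∘_)
open import Function.Bundles using (mk⇔; Equivalence)
open +-*-Solver

+-cancelˡ-≤ : ∀ c {a b} → c + a ≤ c + b → a ≤ b
+-cancelˡ-≤ c {a} {b} c+a≤c+b = subst₂ _≤_ (neg-cancel a) (neg-cancel b) (+-monoʳ-≤ (- c) c+a≤c+b)
  where
  neg-cancel : ∀ y → - c + (c + y) ≡ y
  neg-cancel = solve 2 (λ c y → :- c :+ (c :+ y) := y) refl c

+-cancelʳ-≤ : ∀ c {a b} → a + c ≤ b + c → a ≤ b
+-cancelʳ-≤ c {a} {b} a+c≤b+c = +-cancelˡ-≤ c (subst₂ _≤_ (+-comm a c) (+-comm b c) a+c≤b+c)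

p≤p*q : ∀ {p q} → 0ℚ ≤ p → 1ℚ ≤ q → p ≤ p * q
p≤p*q {p} 0≤p 1≤q = ≤-trans (≤-reflexive (sym (*-identityʳ p))) (*-monoˡ-≤-nonNeg p {{nonNegative 0≤p}} 1≤q)

weightedSum : {A : Set} → (A → ℚ) → (A → ℚ) → List A → ℚ
weightedSum w f ws = sumℚ (map (λ q → w q * f q) ws)

module _ {A : Set} (w : A → ℚ) where

  weightedSum-+ : ∀ f g ws → weightedSum w (λ q → f q + g q) ws ≡ weightedSum w f ws + weightedSum w g ws
  weightedSum-+ f g [] = refl
  weightedSum-+ f g (q ∷ ws) =
    trans (cong (w q * (f q + g q) +_) (weightedSum-+ f g ws))
          (solve 5 (λ w f g X Y → w :* (f :+ g) :+ (X :+ Y) := (w :* f :+ X) :+ (w :* g :+ Y)) refl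
                 (w q) (f q) (g q) (weightedSum w f ws) (weightedSum w g ws))

  weightedSum-1- : ∀ f ws → weightedSum w (λ q → 1ℚ - f q) ws ≡ sumℚ (map w ws) - weightedSum w f ws
  weightedSum-1- f [] = refl
  weightedSum-1- f (q ∷ ws) =
    trans (cong (w q * (1ℚ - f q) +_) (weightedSum-1- f ws))
          (solve 4 (λ w f X Y → w :* (con 1ℚ :- f) :+ (X :- Y) := (w :+ X) :- (w :* f :+ Y)) refl
                 (w q) (f q) (sumℚ (map w ws)) (weightedSum w f ws))

  sum≤weightedSum : ∀ {f} → (∀ q → 1ℚ ≤ f q) → ∀ {ws} → All (λ q → 0ℚ ≤ w q) ws →
                    sumℚ (map w ws) ≤ weightedSum w f ws
  sum≤weightedSum 1≤f []           = ≤-refl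
  sum≤weightedSum 1≤f (0≤w ∷ 0≤ws) = +-mono-≤ (p≤p*q 0≤w (1≤f _)) (sum≤weightedSum 1≤f 0≤ws)

  weightedSum-tight : ∀ {f} → (∀ q → 1ℚ ≤ f q) → ∀ {ws} → All (λ q → 0ℚ ≤ w q) ws →
                      weightedSum w f ws ≤ sumℚ (map w ws) →
                      ∀ {q} → q ∈ₗ ws → 0ℚ < w q → f q ≤ 1ℚ
  weightedSum-tight {f} 1≤f {q ∷ ws} (_ ∷ 0≤ws) avg≤ (here refl) 0<w =
    *-cancelˡ-≤-pos (w q) {{positive 0<w}} (≤-trans wf≤w (≤-reflexive (sym (*-identityʳ (w q)))))
    where
    wf≤w : w q * f q ≤ w q
    wf≤w = +-cancelʳ-≤ (weightedSum w f ws) (≤-trans avg≤ (+-monoʳ-≤ (w q) (sum≤weightedSum 1≤f 0≤ws)))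
  weightedSum-tight {f} 1≤f {q ∷ ws} (0≤w ∷ 0≤ws) avg≤ (there q′∈ws) 0<w′ =
    weightedSum-tight 1≤f 0≤ws
      (+-cancelˡ-≤ (w q) (≤-trans (+-monoˡ-≤ (weightedSum w f ws) (p≤p*q 0≤w (1≤f q))) avg≤)) q′∈ws 0<w′

  positive-weight : ∀ {ws} → All (λ q → 0ℚ ≤ w q) ws → 0ℚ < sumℚ (map w ws) →
                    ∃ λ q → q ∈ₗ ws × 0ℚ < w q
  positive-weight []                       0<0   = ⊥-elim (<-irrefl refl 0<0)
  positive-weight {q ∷ ws} (0≤w ∷ 0≤ws) 0<sum with 0ℚ <? w q
  ... | yes 0<w = q , here refl , 0<w
  ... | no  0≮w =
    let q′ , q′∈ws , 0<w′ = positive-weight 0≤ws (<-≤-trans 0<sum drop-head) in q′ , there q′∈ws , 0<w′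
    where
    drop-head : w q + sumℚ (map w ws) ≤ sumℚ (map w ws)
    drop-head = ≤-trans (+-monoˡ-≤ _ (≮⇒≥ 0≮w)) (≤-reflexive (+-identityˡ _))

halves : ℕ → ℚ
halves zero    = 0ℚ
halves (suc k) = ½ + halves k

halves-+ : ∀ a b → halves (a ℕ.+ b) ≡ halves a + halves b
halves-+ zero    b = sym (+-identityˡ (halves b))
halves-+ (suc a) b = trans (cong (½ +_) (halves-+ a b)) (sym (+-assoc ½ (halves a) (halves b)))

0≤halves : ∀ k → 0ℚ ≤ halves k
0≤halves zero    = ≤-refl
0≤halves (suc k) = +-mono-≤ 0≤½ (0≤halves k)
  where
  0≤½ : 0ℚ ≤ ½
  0≤½ = ≤ᵇ⇒≤ tt

1≤halves : ∀ {k} → 2 ℕ.≤ k → 1ℚ ≤ halves k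
1≤halves {suc (suc k)} (s≤s (s≤s _)) = begin
  1ℚ                   ≡⟨ sym (+-identityʳ 1ℚ) ⟩
  1ℚ + 0ℚ              ≤⟨ +-monoʳ-≤ 1ℚ (0≤halves k) ⟩
  1ℚ + halves k        ≡⟨ +-assoc ½ ½ (halves k) ⟩
  halves (suc (suc k)) ∎
  where open ≤-Reasoning

halves-∷ : ∀ {n} a (I : Subset n) → halves ∣ a ∷ I ∣ ≡ (if a then ½ else 0ℚ) + halves ∣ I ∣
halves-∷ true  _ = refl
halves-∷ false _ = sym (+-identityˡ _)

centre : ∀ {n} → Point n
centre _ = ½

gscTerm : Bool → Bool → ℚ → ℚ
gscTerm a b y = (if a then y else 0ℚ) + (if b then 1ℚ - y else 0ℚ)

gscLHS-∷ : ∀ {n} a b (I J : Subset n) (x : Point (suc n)) →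
           gscLHS (a ∷ I) (b ∷ J) x ≡ gscTerm a b (x zero) + gscLHS I J (x ∘ suc)
gscLHS-∷ {n} a b I J x =
  cong (gscTerm a b (x zero) +_)
       (cong sumℚ (trans (map-tabulate suc term) (sym (map-tabulate (λ i → i) (term ∘ suc)))))
  where
  term : Fin (suc n) → ℚ
  term i = gscTerm (lookup (a ∷ I) i) (lookup (b ∷ J) i) (x i)

gscLHS-centre : ∀ {n} (I J : Subset n) → gscLHS I J centre ≡ halves ∣ I ∣ + halves ∣ J ∣
gscLHS-centre []      []      = refl
gscLHS-centre (a ∷ I) (b ∷ J) = begin
  gscLHS (a ∷ I) (b ∷ J) centre                              ≡⟨ gscLHS-∷ a b I J centre ⟩
  (½-if a + ½-if b) + gscLHS I J centre                      ≡⟨ cong ((½-if a + ½-if b) +_) (gscLHS-centre I J) ⟩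
  (½-if a + ½-if b) + (halves ∣ I ∣ + halves ∣ J ∣)          ≡⟨ interchange (½-if a) (½-if b) _ _ ⟩
  (½-if a + halves ∣ I ∣) + (½-if b + halves ∣ J ∣)          ≡⟨ sym (cong₂ _+_ (halves-∷ a I) (halves-∷ b J)) ⟩
  halves ∣ a ∷ I ∣ + halves ∣ b ∷ J ∣                        ∎
  where
  open ≡-Reasoning
  ½-if : Bool → ℚ
  ½-if c = if c then ½ else 0ℚ
  interchange : ∀ p q X Y → (p + q) + (X + Y) ≡ (p + X) + (q + Y)
  interchange = solve 4 (λ p q X Y → (p :+ q) :+ (X :+ Y) := (p :+ X) :+ (q :+ Y)) refl

centre-satisfies-GSC : ∀ {n} (I J : Subset n) → ∣ I ∣ ℕ.+ ∣ J ∣ ℕ.≥ 2 → GSC I J centre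
centre-satisfies-GSC I J two≤ =
  subst (1ℚ ≤_) (sym (trans (gscLHS-centre I J) (sym (halves-+ ∣ I ∣ ∣ J ∣)))) (1≤halves two≤)

centre∈conv : ∀ {n} {S : SetSystem n} → CubeIdeal S → ConnectivityAtLeast 2 S → InConv S centre
centre∈conv {S = S} (F , conv⇔F) conn =
  Equivalence.from (conv⇔F centre)
    (All.tabulate λ {ι} ι∈F →
      centre-satisfies ι λ x x∈conv → All.lookup (Equivalence.to (conv⇔F x) x∈conv) ι∈F)
  where
  centre-satisfies : ∀ ι → ValidFor S (λ x → Sat x ι) → Sat centre ι
  centre-satisfies (cap≥0 _)       _     = ≤ᵇ⇒≤ tt
  centre-satisfies (cap≤1 _)       _     = ≤ᵇ⇒≤ tt
  centre-satisfies (gsc I J I∩J≡∅) valid = centre-satisfies-GSC I J (conn I J I∩J≡∅ valid)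

literal : Bool → ℚ → ℚ
literal false y = y
literal true  y = 1ℚ - y

literal-complement : ∀ s y → literal s y + literal (not s) y ≡ 1ℚ
literal-complement false = solve 1 (λ y → y :+ (con 1ℚ :- y) := con 1ℚ) refl
literal-complement true  = solve 1 (λ y → (con 1ℚ :- y) :+ y := con 1ℚ) refl

literal-½ : ∀ s → literal s ½ ≡ ½
literal-½ false = refl
literal-½ true  = refl

resolve : ∀ {a c} s y → 1ℚ ≤ a + literal s y → 1ℚ ≤ literal (not s) y + c → 1ℚ ≤ a + c
resolve {a} {c} s y a∨ℓ ¬ℓ∨c =
  +-cancelʳ-≤ 1ℚ (subst (1ℚ + 1ℚ ≤_) regroup (+-mono-≤ a∨ℓ ¬ℓ∨c))
  where
  regroup : (a + literal s y) + (literal (not s) y + c) ≡ (a + c) + 1ℚ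
  regroup = trans (solve 4 (λ a ℓ ℓ′ c → (a :+ ℓ) :+ (ℓ′ :+ c) := (a :+ c) :+ (ℓ :+ ℓ′)) refl
                           a (literal s y) (literal (not s) y) c)
                  (cong ((a + c) +_) (literal-complement s y))

ValidPair : ∀ {n} → SetSystem n → Bool → Fin n → Bool → Fin n → Set
ValidPair S s i s′ j = ValidFor S (λ x → 1ℚ ≤ literal s (x i) + literal s′ (x j))

ValidPair-swap : ∀ {n} {S : SetSystem n} s i s′ j → ValidPair S s i s′ j → ValidPair S s′ j s i
ValidPair-swap s i s′ j valid x x∈conv =
  subst (1ℚ ≤_) (+-comm (literal s (x i)) (literal s′ (x j))) (valid x x∈conv)

TightAt : ∀ {n} → SetSystem n → Point n → Set
TightAt S x = ∀ s i s′ j → ValidPair S s i s′ j → literal s (x i) + literal s′ (x j) ≤ 1ℚ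

centre-tight : ∀ {n} {S : SetSystem n} → TightAt S centre
centre-tight s i s′ j _ = ≤-reflexive (cong₂ _+_ (literal-½ s) (literal-½ s′))

vertex∈conv : ∀ {n} {S : SetSystem n} {t} → S t → InConv S (embed t)
vertex∈conv {t = t} t∈S =
  (((t , t∈S) , 1ℚ) ∷ []) , ≤ᵇ⇒≤ tt ∷ [] , refl , λ i → sym (trans (+-identityʳ _) (*-identityˡ (embed t i)))

module _ {n} {S : SetSystem n} where

  vertex : Σ (Cube n) S × ℚ → Point n
  vertex p = embed (proj₁ (proj₁ p))

  literal-combination : ∀ {x : Point n} (ws : List (Σ (Cube n) S × ℚ)) → sumℚ (map proj₂ ws) ≡ 1ℚ →
                        (∀ i → x i ≡ weightedSum proj₂ (λ p → vertex p i) ws) →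
                        ∀ s i → literal s (x i) ≡ weightedSum proj₂ (λ p → literal s (vertex p i)) ws
  literal-combination ws Σw≡1 x≡ false i = x≡ i
  literal-combination ws Σw≡1 x≡ true  i =
    trans (cong₂ _-_ (sym Σw≡1) (x≡ i)) (sym (weightedSum-1- proj₂ (λ p → vertex p i) ws))

  tight-at-support : ∀ {x} → InConv S x → TightAt S x → Σ (Cube n) λ t → S t × TightAt S (embed t)
  tight-at-support {x} (ws , 0≤w , Σw≡1 , x≡) tight
    with positive-weight proj₂ 0≤w (subst (0ℚ <_) (sym Σw≡1) (positive⁻¹ 1ℚ))
  ... | ((t , t∈S) , _) , p∈ws , 0<w = t , t∈S , tight-at-t
    where
    tight-at-t : TightAt S (embed t)
    tight-at-t s i s′ j valid =
      weightedSum-tight proj₂ (λ p → valid (vertex p) (vertex∈conv (proj₂ (proj₁ p)))) 0≤w average≤1 p∈ws 0<w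
      where
      average≤1 : weightedSum proj₂ (λ p → literal s (vertex p i) + literal s′ (vertex p j)) ws
                  ≤ sumℚ (map proj₂ ws)
      average≤1 = begin
        weightedSum proj₂ (λ p → literal s (vertex p i) + literal s′ (vertex p j)) ws
          ≡⟨ weightedSum-+ proj₂ (λ p → literal s (vertex p i)) (λ p → literal s′ (vertex p j)) ws ⟩
        weightedSum proj₂ (λ p → literal s (vertex p i)) ws + weightedSum proj₂ (λ p → literal s′ (vertex p j)) ws
          ≡⟨ sym (cong₂ _+_ (literal-combination {x} ws Σw≡1 x≡ s i)
                            (literal-combination {x} ws Σw≡1 x≡ s′ j)) ⟩
        literal s (x i) + literal s′ (x j)
          ≤⟨ tight s i s′ j valid ⟩
        1ℚ
          ≡⟨ sym Σw≡1 ⟩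
        sumℚ (map proj₂ ws) ∎
        where open ≤-Reasoning

bit : Bool → ℚ
bit a = if a then 1ℚ else 0ℚ

exactly-one-literal : ∀ s a s′ b → literal s (bit a) + literal s′ (bit b) ≡ 1ℚ →
                      (s ≡ not a × s′ ≡ b) ⊎ (s ≡ a × s′ ≡ not b)
exactly-one-literal false false false false ()
exactly-one-literal false false false true  _  = inj₂ (refl , refl)
exactly-one-literal false false true  false _  = inj₂ (refl , refl)
exactly-one-literal false false true  true  ()
exactly-one-literal false true  false false _  = inj₁ (refl , refl)
exactly-one-literal false true  false true  ()
exactly-one-literal false true  true  false ()
exactly-one-literal false true  true  true  _  = inj₁ (refl , refl)
exactly-one-literal true  false false false _  = inj₁ (refl , refl)
exactly-one-literal true  false false true  ()
exactly-one-literal true  false true  false ()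
exactly-one-literal true  false true  true  _  = inj₁ (refl , refl)
exactly-one-literal true  true  false false ()
exactly-one-literal true  true  false true  _  = inj₂ (refl , refl)
exactly-one-literal true  true  true  false _  = inj₂ (refl , refl)
exactly-one-literal true  true  true  true  ()

coverEdge⇒validPair : ∀ {n} {S : SetSystem n} {i j} → CoverEdge S i j →
                      Σ Bool λ s → Σ Bool λ s′ → ValidPair S s i s′ j
coverEdge⇒validPair (_ , inj₁ valid)                 = false , true  , valid
coverEdge⇒validPair (_ , inj₂ (inj₁ valid))          = true  , false , valid
coverEdge⇒validPair (_ , inj₂ (inj₂ (inj₁ valid)))   = false , false , valid
coverEdge⇒validPair (_ , inj₂ (inj₂ (inj₂ valid)))   = true  , true  , valid

validPair⇒coverEdge : ∀ {n} {S : SetSystem n} {i j} → i ≢ j →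
                      ∀ s s′ → ValidPair S s i s′ j → CoverEdge S i j
validPair⇒coverEdge i≢j false true  valid = i≢j , inj₁ valid
validPair⇒coverEdge i≢j true  false valid = i≢j , inj₂ (inj₁ valid)
validPair⇒coverEdge i≢j false false valid = i≢j , inj₂ (inj₂ (inj₁ valid))
validPair⇒coverEdge i≢j true  true  valid = i≢j , inj₂ (inj₂ (inj₂ valid))

module _ {n} {S : SetSystem n} {t : Cube n} (t∈S : S t) (tight : TightAt S (embed t)) where

  -- literal (not (t i)) is the literal of i that is true at t, literal (t j) the one of j that is false at t.
  _≲_ : Fin n → Fin n → Set
  i ≲ j = ValidPair S (not (t i)) i (t j) j

  ≲-isPreorder : IsPreorder _≡_ _≲_
  ≲-isPreorder = record
    { isEquivalence = isEquivalence
    ; reflexive     = λ { {i} refl x _ →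
                        ≤-reflexive (sym (trans (+-comm (literal (not (t i)) (x i)) _) (literal-complement (t i) (x i)))) }
    ; trans         = λ {i} {j} {k} i≲j j≲k x x∈conv →
                        resolve {literal (not (t i)) (x i)} (t j) (x j) (i≲j x x∈conv) (j≲k x x∈conv)
    }

  validPair⇒comparable : ∀ {i j} s s′ → ValidPair S s i s′ j → i ≲ j ⊎ j ≲ i
  validPair⇒comparable {i} {j} s s′ valid
    with exactly-one-literal s (t i) s′ (t j) (≤-antisym (tight s i s′ j valid) (valid _ (vertex∈conv t∈S)))
  ... | inj₁ (refl , refl) = inj₁ valid
  ... | inj₂ (refl , refl) = inj₂ (ValidPair-swap s i s′ j valid)

  comparable⇒validPair : ∀ {i j} → i ≲ j ⊎ j ≲ i → Σ Bool λ s → Σ Bool λ s′ → ValidPair S s i s′ j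
  comparable⇒validPair {i} {j} (inj₁ i≲j) = not (t i) , t j , i≲j
  comparable⇒validPair {i} {j} (inj₂ j≲i) = t i , not (t j) , ValidPair-swap (not (t j)) j (t i) i j≲i

  coverGraph-isComparabilityGraph : IsComparabilityGraph (CoverEdge S)
  coverGraph-isComparabilityGraph = _≲_ , ≲-isPreorder , λ i j → mk⇔
    (λ edge@(i≢j , _) → let s , s′ , valid = coverEdge⇒validPair edge in i≢j , validPair⇒comparable s s′ valid)
    (λ (i≢j , comparable) →
      let s , s′ , valid = comparable⇒validPair comparable in validPair⇒coverEdge i≢j s s′ valid)

theorem4p2 : (n : ℕ) (S : SetSystem n) → CubeIdeal S → ConnectivityAtLeast 2 S
             → IsComparabilityGraph (CoverEdge S)
theorem4p2 n S ideal conn =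
  let t , t∈S , tight = tight-at-support (centre∈conv ideal conn) centre-tight
  in coverGraph-isComparabilityGraph t∈S tight
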